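{- Let $k\ge 3$ be odd, $n\ge1$, and let $EQ_k:(\{0,1\}^n)^k\to\{0,1\}$ be defined by $EQ_k(x_1,\dots,x_k)=1$ iff $x_1=\dots=x_k$. Then $D^{\mathrm{NOF}}\big(EQ_k^{(k-1)/2}\big)\le 1+\frac{k-1}{2}$.
   Context: Number-on-the-forehead (NOF) model: $k$ parties $P_1,\dots,P_k$; each input argument is seen by every party except the one on whose forehead it is. Parties communicate by writing bits on a shared board visible to all; all parties must learn the output. $D^{\mathrm{NOF}}(g)$ is the minimum, over deterministic NOF protocols computing $g$, of the worst-case number of bits written on the board. $f^{\ell}$ denotes computing $f$ on $\ell$ independent instances: the input consists of $x_{i,j}\in\{0,1\}^n$ ($i\in[\ell]$, $j\in[k]$), with $x_{i,j}$ the $j$-th argument of instance $i$, on $P_j$'s forehead; all parties must learn $f$'s value on every instance. -}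

module Defs where

open import Data.Nat using (ℕ; zero; suc; _+_; _*_; _≤_)
open import Data.Bool using (Bool; true; false; if_then_else_)
import Data.Bool as B
open import Data.Fin using (Fin)
open import Data.Fin.Properties using (all?)
open import Data.Vec using (Vec; tabulate)
open import Data.Vec.Properties using (≡-dec)
open import Data.Product using (Σ; _×_)
open import Relation.Nullary using (¬_)
open import Relation.Nullary.Decidable using (⌊_⌋)
open import Relation.Binary.PropositionalEquality using (_≡_)

BitString : ℕ → Set
BitString n = Vec Bool n

-- Inputs of the ℓ-fold problem with k arguments of n bits each:
-- x i j = x_{i,j}, the j-th argument of instance i, on P_j's forehead.
Input : ℕ → ℕ → ℕ → Set
Input ℓ k n = Fin ℓ → Fin k → BitString n

SameView : ∀ {ℓ k n} → Fin k → Input ℓ k n → Input ℓ k n → Set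
SameView {ℓ} {k} j x y = (i : Fin ℓ) (m : Fin k) → ¬ (m ≡ j) → x i m ≡ y i m

SeenBy : ∀ {ℓ k n} {A : Set} → Fin k → (Input ℓ k n → A) → Set
SeenBy {ℓ} {k} {n} j g = (x y : Input ℓ k n) → SameView j x y → g x ≡ g y

-- Deterministic NOF protocol trees with k parties.
-- node j b t f : party P_j writes the bit b(x) on the board; continue with t if
--   the bit is true, with f if it is false.
-- leaf out : the protocol ends; party P_j announces out j x as the output.
data Protocol (ℓ k n : ℕ) (O : Set) : Set where
  leaf : (Fin k → Input ℓ k n → O) → Protocol ℓ k n O
  node : Fin k → (Input ℓ k n → Bool) → Protocol ℓ k n O → Protocol ℓ k n O → Protocol ℓ k n O

-- Legality: every bit written by P_j, and every party's final output,
-- depends only on the board (the position in the tree) and on what that party sees.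
Legal : ∀ {ℓ k n O} → Protocol ℓ k n O → Set
Legal (leaf out) = ∀ j → SeenBy j (out j)
Legal (node j b t f) = SeenBy j b × Legal t × Legal f

outputOf : ∀ {ℓ k n O} → Protocol ℓ k n O → Input ℓ k n → Fin k → O
outputOf (leaf out) x j = out j x
outputOf (node _ b t f) x j = if b x then outputOf t x j else outputOf f x j

bits : ∀ {ℓ k n O} → Protocol ℓ k n O → Input ℓ k n → ℕ
bits (leaf _) x = 0
bits (node _ b t f) x = suc (if b x then bits t x else bits f x)

Computes : ∀ {ℓ k n O} → Protocol ℓ k n O → (Input ℓ k n → O) → Set
Computes {ℓ} {k} {n} P g = (x : Input ℓ k n) (j : Fin k) → outputOf P x j ≡ g x

DNOF≤ : ∀ {ℓ k n O} → (Input ℓ k n → O) → ℕ → Set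
DNOF≤ {ℓ} {k} {n} {O} g c =
  Σ (Protocol ℓ k n O) λ P → Legal P × Computes P g × ((x : Input ℓ k n) → bits P x ≤ c)

EQ : ∀ {k n} → (Fin k → BitString n) → Bool
EQ x = ⌊ all? (λ a → all? (λ b → ≡-dec B._≟_ (x a) (x b))) ⌋

EQ^ : ∀ {ℓ k n} → Input ℓ k n → Vec Bool ℓ
EQ^ x = tabulate (λ i → EQ (x i))

-- With k ≥ m + 2 parties, reserve a parity writer w, a reference party r
-- and a distinct owner party for each of the m instances.  In instance i
-- the owner writes whether all arguments it sees (every one but its own)
-- agree; together with any other party's corresponding test this decides
-- equality, since for k ≥ 3 two such tests share a third witness.  The owner
-- itself additionally needs the bit [x_owner = x_r] of its own instance,
-- which it cannot see; w announces the parity of these m bits, and the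
-- owner recovers its bit by cancelling the other m − 1 bits, all of which
-- it sees.
module Submission where

open import Defs
open import Algebra.Bundles using (CommutativeRing)
open import Data.Bool using (Bool; true; false; _∧_; _xor_)
import Data.Bool as Bool
open import Data.Bool.Properties
  using (xor-∧-commutativeRing; xor-assoc; xor-same; xor-identityʳ)
open import Data.Fin using (Fin; zero; suc; _↑ˡ_; _↑ʳ_; splitAt; punchIn)
  renaming (_≟_ to _≟ᶠ_)
open import Data.Fin.Properties
  using (all?; suc-injective; ↑ˡ-injective; splitAt-↑ˡ; splitAt-↑ʳ; punchInᵢ≢i)
open import Data.Nat using (ℕ; zero; suc; _+_; _*_; _≤_; s≤s)
open import Data.Nat.Properties using (≤-reflexive)
open import Data.Product using (Σ; _×_; _,_)
open import Data.Vec using (Vec; []; _∷_; map; lookup; tabulate)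
open import Data.Vec.Properties using (≡-dec; lookup∘tabulate; tabulate-∘; tabulate-cong)
open import Data.Vec.Functional using (removeAt)
open import Data.Vec.Relation.Unary.All using (All; []; _∷_)
open import Data.Vec.Relation.Unary.All.Properties using (tabulate⁺)
open import Function using (_∘_; Injective; _⇔_; mk⇔)
open import Relation.Nullary using (Dec; does; yes; no; ¬?; _×-dec_; _→-dec_)
open import Relation.Nullary.Decidable using (does-⇔; isYes≗does)
open import Relation.Binary.PropositionalEquality
  using (_≡_; _≢_; refl; sym; trans; cong; cong₂; module ≡-Reasoning)
open import Algebra.Properties.CommutativeMonoid.Sum
  (CommutativeRing.+-commutativeMonoid xor-∧-commutativeRing)
  using (sum-remove; sum-cong-≗) renaming (sum to parity)

open ≡-Reasoning

module Oblivious {ℓ k n : ℕ} {O : Set} where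

  Bit : Set
  Bit = Fin k × (Input ℓ k n → Bool)

  LegalBit : Bit → Set
  LegalBit (j , b) = SeenBy j b

  board : ∀ {L} → Vec Bit L → Input ℓ k n → Vec Bool L
  board bs x = map (λ (_ , b) → b x) bs

  oblivious : ∀ {L} → Vec Bit L → (Vec Bool L → Fin k → Input ℓ k n → O) →
              Protocol ℓ k n O
  oblivious [] out = leaf (out [])
  oblivious ((j , b) ∷ bs) out =
    node j b (oblivious bs (out ∘ (true ∷_))) (oblivious bs (out ∘ (false ∷_)))

  bits-oblivious : ∀ {L} (bs : Vec Bit L) out x → bits (oblivious bs out) x ≡ L
  bits-oblivious [] out x = refl
  bits-oblivious ((j , b) ∷ bs) out x with b x
  ... | true = cong suc (bits-oblivious bs _ x)
  ... | false = cong suc (bits-oblivious bs _ x)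

  outputOf-oblivious : ∀ {L} (bs : Vec Bit L) out x j →
                       outputOf (oblivious bs out) x j ≡ out (board bs x) j x
  outputOf-oblivious [] out x j = refl
  outputOf-oblivious ((_ , b) ∷ bs) out x j with b x
  ... | true = outputOf-oblivious bs _ x j
  ... | false = outputOf-oblivious bs _ x j

  legal-oblivious : ∀ {L} (bs : Vec Bit L) out → All LegalBit bs →
                    (∀ v j → SeenBy j (out v j)) → Legal (oblivious bs out)
  legal-oblivious [] out [] out-seen = out-seen []
  legal-oblivious (_ ∷ bs) out (b-seen ∷ bs-seen) out-seen =
      b-seen
    , legal-oblivious bs _ bs-seen (out-seen ∘ (true ∷_))
    , legal-oblivious bs _ bs-seen (out-seen ∘ (false ∷_))

_≟ₛ_ : ∀ {n} (u v : BitString n) → Dec (u ≡ v)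
_≟ₛ_ = ≡-dec Bool._≟_

module _ {k n : ℕ} where

  Instance : Set
  Instance = Fin k → BitString n

  AllEqual : Instance → Set
  AllEqual v = ∀ a b → v a ≡ v b

  allEqual? : (v : Instance) → Dec (AllEqual v)
  allEqual? v = all? λ a → all? λ b → v a ≟ₛ v b

  EqualOff : Fin k → Instance → Set
  EqualOff j v = ∀ a b → a ≢ j → b ≢ j → v a ≡ v b

  equalOff? : (j : Fin k) (v : Instance) → Dec (EqualOff j v)
  equalOff? j v =
    all? λ a → all? λ b → ¬? (a ≟ᶠ j) →-dec ¬? (b ≟ᶠ j) →-dec v a ≟ₛ v b

  allEqual-via : ∀ {v} t → (∀ a → v a ≡ v t) → AllEqual v
  allEqual-via t to-t a b = trans (to-t a) (sym (to-t b))

  allEqual⇒equalOff : ∀ {v} j → AllEqual v → EqualOff j v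
  allEqual⇒equalOff j eq a b _ _ = eq a b

  equalOff-transport : ∀ {j u w} → (∀ a → a ≢ j → u a ≡ w a) → EqualOff j u → EqualOff j w
  equalOff-transport u≈w off a b a≢j b≢j =
    trans (sym (u≈w a a≢j)) (trans (off a b a≢j b≢j) (u≈w b b≢j))

  allEqual⇔equalOff×anchored : ∀ {v j c} → c ≢ j → AllEqual v ⇔ (EqualOff j v × v j ≡ v c)
  allEqual⇔equalOff×anchored {v} {j} {c} c≢j =
    mk⇔ (λ eq → allEqual⇒equalOff j eq , eq j c) from
    where
    from : EqualOff j v × v j ≡ v c → AllEqual v
    from (off , anchored) = allEqual-via c to-c
      where
      to-c : ∀ a → v a ≡ v c
      to-c a with a ≟ᶠ j
      ... | yes refl = anchored
      ... | no a≢j = off a c a≢j c≢j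

  allEqual⇔equalOff×equalOff : ∀ {v l q t} → l ≢ q → t ≢ l → t ≢ q →
                               AllEqual v ⇔ (EqualOff l v × EqualOff q v)
  allEqual⇔equalOff×equalOff {v} {l} {q} {t} l≢q t≢l t≢q =
    mk⇔ (λ eq → allEqual⇒equalOff l eq , allEqual⇒equalOff q eq) from
    where
    from : EqualOff l v × EqualOff q v → AllEqual v
    from (off-l , off-q) = allEqual-via t to-t
      where
      to-t : ∀ a → v a ≡ v t
      to-t a with a ≟ᶠ l
      ... | yes refl = off-q a t l≢q t≢q
      ... | no a≢l = off-l a t a≢l t≢l

module _ {ℓ k n : ℕ} where

  equalOff-seen : ∀ j (i : Fin ℓ) → SeenBy {ℓ} {k} {n} j (λ x → does (equalOff? j (x i)))
  equalOff-seen j i x y x~y =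
    does-⇔ (mk⇔ (equalOff-transport (x~y i)) (equalOff-transport (λ a a≢j → sym (x~y i a a≢j))))
           (equalOff? j (x i)) (equalOff? j (y i))

  agreement-seen : ∀ {j} a b (i : Fin ℓ) → a ≢ j → b ≢ j →
                   SeenBy {ℓ} {k} {n} j (λ x → does (x i a ≟ₛ x i b))
  agreement-seen a b i a≢j b≢j x y x~y =
    cong₂ (λ u w → does (u ≟ₛ w)) (x~y i a a≢j) (x~y i b b≢j)

parityWithout : ∀ {m} → (Fin m → Bool) → Fin m → Bool
parityWithout {zero} f ()
parityWithout {suc m} f i = parity (removeAt f i)

parityWithout-cong : ∀ {m} {f g : Fin m → Bool} i → (∀ l → l ≢ i → f l ≡ g l) →
                     parityWithout f i ≡ parityWithout g i
parityWithout-cong {zero} () f≈g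
parityWithout-cong {suc m} i f≈g = sum-cong-≗ λ l → f≈g (punchIn i l) (punchInᵢ≢i i l)

parity-xor-parityWithout : ∀ {m} (f : Fin m → Bool) i → parity f xor parityWithout f i ≡ f i
parity-xor-parityWithout {zero} f ()
parity-xor-parityWithout {suc m} f i = begin
  parity f xor rest           ≡⟨ cong (_xor rest) (sum-remove {i = i} f) ⟩
  (f i xor rest) xor rest     ≡⟨ xor-assoc (f i) rest rest ⟩
  f i xor (rest xor rest)     ≡⟨ cong (f i xor_) (xor-same rest) ⟩
  f i xor false               ≡⟨ xor-identityʳ (f i) ⟩
  f i                         ∎
  where
  rest : Bool
  rest = parityWithout f i

module ParityProtocol {m k n : ℕ} (w r : Fin k) (owner : Fin m → Fin k)
  (owner-injective : Injective _≡_ _≡_ owner) (w≢r : w ≢ r)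
  (owner≢w : ∀ i → owner i ≢ w) (owner≢r : ∀ i → owner i ≢ r) where

  open Oblivious {m} {k} {n} {Vec Bool m}

  agreeOff : Fin k → Fin m → Input m k n → Bool
  agreeOff j i x = does (equalOff? j (x i))

  ownerMatchesRef : Input m k n → Fin m → Bool
  ownerMatchesRef x i = does (x i (owner i) ≟ₛ x i r)

  ownerBits : Input m k n → Vec Bool m
  ownerBits x = tabulate λ i → agreeOff (owner i) i x

  written : Vec Bit (suc m)
  written = (w , parity ∘ ownerMatchesRef) ∷ tabulate (λ i → owner i , agreeOff (owner i) i)

  board-written : ∀ x → board written x ≡ parity (ownerMatchesRef x) ∷ ownerBits x
  board-written x = cong (parity (ownerMatchesRef x) ∷_) (sym (tabulate-∘ _ _))

  answerAt : Bool → Vec Bool m → Fin k → Input m k n → Fin m → Bool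
  answerAt c b j x i with j ≟ᶠ owner i
  ... | yes _ = agreeOff j i x ∧ (c xor parityWithout (ownerMatchesRef x) i)
  ... | no _ = agreeOff j i x ∧ lookup b i

  answer : Vec Bool (suc m) → Fin k → Input m k n → Vec Bool m
  answer (c ∷ b) j x = tabulate (answerAt c b j x)

  written-legal : All LegalBit written
  written-legal =
      (λ x y x~y → sum-cong-≗ λ i →
         agreement-seen (owner i) r i (owner≢w i) (w≢r ∘ sym) x y x~y)
    ∷ tabulate⁺ {P = LegalBit} {f = λ i → owner i , agreeOff (owner i) i}
                (λ i → equalOff-seen (owner i) i)

  answerAt-seen : ∀ c b j i → SeenBy j (λ x → answerAt c b j x i)
  answerAt-seen c b j i x y x~y with j ≟ᶠ owner i
  ... | no _ = cong (_∧ lookup b i) (equalOff-seen j i x y x~y)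
  ... | yes refl = cong₂ _∧_ (equalOff-seen (owner i) i x y x~y)
                     (cong (c xor_) (parityWithout-cong i λ l l≢i →
                        agreement-seen _ r l (l≢i ∘ owner-injective) (owner≢r i ∘ sym) x y x~y))

  answer-seen : ∀ v j → SeenBy j (answer v j)
  answer-seen (c ∷ b) j x y x~y = tabulate-cong λ i → answerAt-seen c b j i x y x~y

  bystander : ∀ j i → Σ (Fin k) λ t → t ≢ j × t ≢ owner i
  bystander j i with j ≟ᶠ w
  ... | yes refl = r , w≢r ∘ sym , owner≢r i ∘ sym
  ... | no j≢w = w , j≢w ∘ sym , owner≢w i ∘ sym

  answerAt-correct : ∀ x j i → answerAt (parity (ownerMatchesRef x)) (ownerBits x) j x i ≡ EQ (x i)
  answerAt-correct x j i with j ≟ᶠ owner i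
  ... | yes refl = begin
    agreeOff j i x ∧ (parity (ownerMatchesRef x) xor parityWithout (ownerMatchesRef x) i)
      ≡⟨ cong (agreeOff j i x ∧_) (parity-xor-parityWithout (ownerMatchesRef x) i) ⟩
    does (equalOff? j (x i) ×-dec (x i j ≟ₛ x i r))
      ≡⟨ does-⇔ (allEqual⇔equalOff×anchored (owner≢r i ∘ sym))
                (allEqual? (x i)) (equalOff? j (x i) ×-dec (x i j ≟ₛ x i r)) ⟨
    does (allEqual? (x i))
      ≡⟨ isYes≗does _ ⟨
    EQ (x i) ∎
  ... | no j≢owner with bystander j i
  ...   | t , t≢j , t≢owner = begin
    agreeOff j i x ∧ lookup (ownerBits x) i
      ≡⟨ cong (agreeOff j i x ∧_) (lookup∘tabulate _ i) ⟩
    does (equalOff? j (x i) ×-dec equalOff? (owner i) (x i))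
      ≡⟨ does-⇔ (allEqual⇔equalOff×equalOff j≢owner t≢j t≢owner)
                (allEqual? (x i)) (equalOff? j (x i) ×-dec equalOff? (owner i) (x i)) ⟨
    does (allEqual? (x i))
      ≡⟨ isYes≗does _ ⟨
    EQ (x i) ∎

  EQ^-protocol : DNOF≤ {m} {k} {n} EQ^ (1 + m)
  EQ^-protocol =
      oblivious written answer
    , legal-oblivious written answer written-legal answer-seen
    , (λ x j → begin
        outputOf (oblivious written answer) x j ≡⟨ outputOf-oblivious written answer x j ⟩
        answer (board written x) j x            ≡⟨ cong (λ v → answer v j x) (board-written x) ⟩
        tabulate (answerAt _ _ j x)             ≡⟨ tabulate-cong (answerAt-correct x j) ⟩
        EQ^ x                                   ∎)
    , λ x → ≤-reflexive (bits-oblivious written answer x)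

EQ^-upper-bound : ∀ m r n → DNOF≤ {m} {suc (m + suc r)} {n} EQ^ (1 + m)
EQ^-upper-bound m r n =
  ParityProtocol.EQ^-protocol zero (suc (m ↑ʳ zero)) owner
    (↑ˡ-injective (suc r) _ _ ∘ suc-injective) (λ ()) (λ _ ()) owner≢r
  where
  owner : Fin m → Fin (suc (m + suc r))
  owner i = suc (i ↑ˡ suc r)

  owner≢r : ∀ i → owner i ≢ suc (m ↑ʳ zero)
  owner≢r i eq with trans (sym (splitAt-↑ˡ m i (suc r)))
                      (trans (cong (splitAt m) (suc-injective eq)) (splitAt-↑ʳ m (suc r) zero))
  ... | ()

proposition2 : (k m n : ℕ) → k ≡ 1 + 2 * m → 3 ≤ k → 1 ≤ n →
    DNOF≤ {m} {k} {n} EQ^ (1 + m)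
proposition2 _ zero n refl (s≤s ()) _
proposition2 _ (suc m) n refl _ _ = EQ^-upper-bound (suc m) (m + 0) n
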